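{- Let $G=(V,E)$ be a finite sober connected graph. Then: (i) $\mathrm{c\text{ - }rk}\,G=0$ iff $G$ is the empty graph; (ii) $\mathrm{c\text{ - }rk}\,G=1$ iff $G\cong K_1$; (iii) $\mathrm{c\text{ - }rk}\,G=2$ iff $G\cong K_2$; (iv) $\mathrm{c\text{ - }rk}\,G=3$ iff $|E|\ge2$ and $G$ has no squares; (v) $\mathrm{c\text{ - }rk}\,G=4$ iff $G$ has a square but no subgraph consisting of five distinct vertices $v_1,\dots,v_5$ with $v_1$ and $v_5$ each adjacent to all of $v_2,v_3,v_4$ and $\mathrm{St}(v_2)\cap\mathrm{St}(v_3)\not\subseteq\mathrm{St}(v_4)$; (vi) $\mathrm{c\text{ - }rk}\,G\ge5$ iff $G$ has such a subgraph.
   Context: Graphs are finite, undirected, without loops or multiple edges; a square is a cycle of length 4 (as a subgraph). $\mathrm{St}(v)$ is the set of neighbours of $v$; $G$ is sober if $v\mapsto\mathrm{St}(v)$ is injective. $\mathrm{c\text{ - }rk}\,G$ is the maximum number of independent columns of the $V\times V$ boolean matrix $A^c$ (entry $0$ if $\{i,j\}\in E$, else $1$), where vectors over the superboolean semiring $\{0,1,1^\nu\}$ (with $0+x=x$, $1+1=1^\nu$, $1^\nu+x=1^\nu$, $0\cdot x=0$, $1\cdot1=1$, $1\cdot1^\nu=1^\nu\cdot1^\nu=1^\nu$) are dependent if some $\{0,1\}$-combination with not all coefficients zero has all coordinates in $\{0,1^\nu\}$, and independent otherwise. -}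

module Defs where

open import Data.Nat using (ℕ; zero; suc; _≤_)
open import Data.Bool using (Bool; true; false; if_then_else_; _∧_)
open import Data.Fin using (Fin; toℕ)
open import Data.Fin.Subset using (Subset; _∈_; _⊆_; ∣_∣; Nonempty)
open import Data.Vec using (lookup)
open import Data.List using (map; allFin)
open import Data.Nat.ListAction using (sum)
open import Data.Nat using (_<ᵇ_)
open import Data.Product using (Σ; ∃; _×_; ∃-syntax)
open import Relation.Nullary using (¬_)
open import Relation.Binary.PropositionalEquality using (_≡_; _≢_)
open import Function.Bundles using (_↔_; Inverse)

record Graph : Set where
  field
    n      : ℕ
    adj    : Fin n → Fin n → Bool
    adj-sym    : ∀ u v → adj u v ≡ adj v u
    adj-irrefl : ∀ v → adj v v ≡ false
open Graph public

Adj : (G : Graph) → Fin (n G) → Fin (n G) → Set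
Adj G u v = adj G u v ≡ true

Sober : Graph → Set
Sober G = ∀ u v → (∀ w → adj G u w ≡ adj G v w) → u ≡ v

data Reachable (G : Graph) : Fin (n G) → Fin (n G) → Set where
  here : ∀ {u} → Reachable G u u
  step : ∀ {u v w} → Adj G u v → Reachable G v w → Reachable G u w

Connected : Graph → Set
Connected G = ∀ u v → Reachable G u v

complete : ℕ → Graph
complete m = record { n = m ; adj = λ u v → neq u v ; adj-sym = symNeq ; adj-irrefl = irr }
  where
  open import Data.Fin using (_≟_)
  open import Relation.Nullary using (yes; no)
  open import Relation.Binary.PropositionalEquality using (refl; sym)
  neq : Fin m → Fin m → Bool
  neq u v with u ≟ v
  ... | yes _ = false
  ... | no _  = true
  symNeq : ∀ u v → neq u v ≡ neq v u
  symNeq u v with u ≟ v | v ≟ u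
  ... | yes _ | yes _ = refl
  ... | yes p | no q  = Data.Empty.⊥-elim (q (sym p))
    where import Data.Empty
  ... | no p  | yes q = Data.Empty.⊥-elim (p (sym q))
    where import Data.Empty
  ... | no _  | no _  = refl
  irr : ∀ v → neq v v ≡ false
  irr v with v ≟ v
  ... | yes _ = refl
  ... | no p  = Data.Empty.⊥-elim (p refl)
    where import Data.Empty

_≅_ : Graph → Graph → Set
G ≅ H = Σ (Fin (n G) ↔ Fin (n H)) λ f →
          ∀ u v → adj H (Inverse.to f u) (Inverse.to f v) ≡ adj G u v

numEdges : Graph → ℕ
numEdges G = sum (map (λ i → sum (map (λ j →
               if adj G i j ∧ (toℕ i <ᵇ toℕ j) then 1 else 0) (allFin (n G)))) (allFin (n G)))

HasSquare : Graph → Set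
HasSquare G = ∃[ a ] ∃[ b ] ∃[ c ] ∃[ d ]
  ((a ≢ b × a ≢ c × a ≢ d × b ≢ c × b ≢ d × c ≢ d) ×
   (Adj G a b × Adj G b c × Adj G c d × Adj G d a))

HasFive : Graph → Set
HasFive G = ∃[ v₁ ] ∃[ v₂ ] ∃[ v₃ ] ∃[ v₄ ] ∃[ v₅ ]
  ((v₁ ≢ v₂ × v₁ ≢ v₃ × v₁ ≢ v₄ × v₁ ≢ v₅ × v₂ ≢ v₃ ×
    v₂ ≢ v₄ × v₂ ≢ v₅ × v₃ ≢ v₄ × v₃ ≢ v₅ × v₄ ≢ v₅) ×
   (Adj G v₁ v₂ × Adj G v₁ v₃ × Adj G v₁ v₄ ×
    Adj G v₅ v₂ × Adj G v₅ v₃ × Adj G v₅ v₄) ×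
   (∃[ w ] (Adj G v₂ w × Adj G v₃ w × ¬ Adj G v₄ w)))

-- The superboolean semiring {0, 1, 1^ν}

data SB : Set where
  𝟘 𝟙 ν : SB

infixl 6 _⊕_
infixl 7 _⊗_

_⊕_ : SB → SB → SB
𝟘 ⊕ x = x
𝟙 ⊕ 𝟘 = 𝟙
𝟙 ⊕ 𝟙 = ν
𝟙 ⊕ ν = ν
ν ⊕ x = ν

_⊗_ : SB → SB → SB
𝟘 ⊗ x = 𝟘
𝟙 ⊗ x = x
ν ⊗ 𝟘 = 𝟘
ν ⊗ 𝟙 = ν
ν ⊗ ν = ν

ΣSB : ∀ {k} → (Fin k → SB) → SB
ΣSB {zero}  f = 𝟘
ΣSB {suc k} f = f Fin.zero ⊕ ΣSB (λ j → f (Fin.suc j))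

Ac : (G : Graph) → Fin (n G) → Fin (n G) → SB
Ac G i j = if adj G i j then 𝟘 else 𝟙

coef : ∀ {k} → Subset k → Fin k → SB
coef c j = if lookup c j then 𝟙 else 𝟘

combo : (G : Graph) → Subset (n G) → Fin (n G) → SB
combo G c i = ΣSB (λ j → coef c j ⊗ Ac G i j)

Dependent : (G : Graph) → Subset (n G) → Set
Dependent G S = ∃[ c ] (c ⊆ S × Nonempty c × (∀ i → combo G c i ≢ 𝟙))

Independent : (G : Graph) → Subset (n G) → Set
Independent G S = ¬ Dependent G S

CRkEq : Graph → ℕ → Set
CRkEq G r = (∃[ S ] (Independent G S × ∣ S ∣ ≡ r)) ×
            (∀ S → Independent G S → ∣ S ∣ ≤ r)

CRkGe : Graph → ℕ → Set
CRkGe G r = ∃[ S ] (Independent G S × r ≤ ∣ S ∣)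

module Submission where

-- A coordinate i of a {0,1}-combination of the columns c of A^c is 𝟙 exactly when row i
-- isolates a column a of c: i is not adjacent to a but adjacent to every other column of c
-- (a superboolean sum is 𝟙 iff exactly one summand is 𝟙).  So S is independent iff every
-- nonempty c ⊆ S has an isolating row (isolable⇒independent, independent⇒isolable).
--
-- Lower bounds grow independent sets one column at a time (extend): a row missing the new
-- column and seeing all old ones isolates it.  Soberness supplies separating vertices, which
-- give independent pairs (pair) and let two vertices seeing a whole independent set add two
-- columns to it (addTwo).  Upper bounds run backwards (peel, twoRows): the isolating rows of
-- 4, resp. 5, independent columns span a square, resp. the configuration of HasFive.
-- Reading c-rk G = r as "c-rk G ≥ r but not ≥ r + 1" (crkEq⇔), the corollary follows from
-- these characterisations of c-rk G ≥ k for k ≤ 3 (by the number of vertices), k = 4 and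
-- k = 5, plus: small connected graphs are K₁ and K₂, and a connected graph has two edges
-- iff it has three vertices.

open import Defs
open import Data.Nat using (ℕ; zero; suc; _+_; _≤_; _<_; z≤n; s≤s; _<ᵇ_; _≤?_; _<?_)
open import Data.Nat.Properties
  using (≤-refl; ≤-reflexive; <-irrefl; ≤-trans; ≤-antisym; ≤-pred; m≤n⇒m≤1+n; ≮⇒≥; ≰⇒>; <⇒≱;
         ≤∧≢⇒<; <⇒<ᵇ; m≤m+n; m≤n+m; +-comm; +-mono-≤; +-monoʳ-≤)
open import Data.Nat.ListAction using (sum)
open import Data.Bool using (Bool; true; false; if_then_else_; _∧_)
import Data.Bool as Bool
open import Data.Bool.Properties using (T-≡)
open import Data.Fin.Properties using (any?; ¬∀⟶∃¬; toℕ-injective; cantor-schröder-bernstein)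
open import Data.Fin using (Fin; toℕ; _≟_; fromℕ<) renaming (zero to 0F; suc to sucF)
open import Data.Fin.Subset using (Subset; _∈_; _∉_; _⊆_; ∣_∣; Nonempty; ⁅_⁆; _∪_; _-_)
  renaming (⊥ to ∅)
open import Data.Fin.Subset.Properties
  using (_∈?_; ∉⊥; ∣⊥∣≡0; ∣p∣≤n; p─⊥≡p; p─q⊆p; ∪-identityˡ; x∈⁅y⁆⇒x≡y; x∈p∪q⁻;
         nonempty?; Empty-unique)
open import Data.List using (map; allFin; tabulate)
open import Data.List.Properties using (map-tabulate)
open import Data.Vec using (_∷_; here; there; lookup)
open import Data.Vec.Properties using ([]=⇒lookup; lookup⇒[]=)
open import Data.Product using (Σ; ∃-syntax; _×_; _,_; proj₁; proj₂)
open import Data.Sum using (_⊎_; inj₁; inj₂)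
open import Data.Empty using (⊥; ⊥-elim)
open import Relation.Nullary using (¬_; Dec; yes; no)
open import Relation.Nullary.Decidable using (_⊎-dec_)
open import Function.Bundles using (_⇔_; mk⇔; Equivalence; Injection)
open import Function.Properties.Inverse using (↔-refl; ↔-sym; ↔⇒↣)
open import Function.Properties.Equivalence using () renaming (trans to ⇔-trans; sym to ⇔-sym)
open import Function.Related.TypeIsomorphisms using (¬-cong-⇔)
open import Data.Product.Function.NonDependent.Propositional using (_×-⇔_)
open import Relation.Binary.PropositionalEquality
  using (_≡_; _≢_; refl; sym; trans; cong; cong₂; subst; ≢-sym)

∣⁅x⁆∪p∣≡1+∣p∣ : ∀ {m} {x : Fin m} (p : Subset m) → x ∉ p → ∣ ⁅ x ⁆ ∪ p ∣ ≡ suc ∣ p ∣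
∣⁅x⁆∪p∣≡1+∣p∣ {x = 0F}     (true  ∷ p) x∉p = ⊥-elim (x∉p here)
∣⁅x⁆∪p∣≡1+∣p∣ {x = 0F}     (false ∷ p) x∉p = cong (λ q → suc ∣ q ∣) (∪-identityˡ p)
∣⁅x⁆∪p∣≡1+∣p∣ {x = sucF x} (true  ∷ p) x∉p = cong suc (∣⁅x⁆∪p∣≡1+∣p∣ p (λ x∈p → x∉p (there x∈p)))
∣⁅x⁆∪p∣≡1+∣p∣ {x = sucF x} (false ∷ p) x∉p = ∣⁅x⁆∪p∣≡1+∣p∣ p (λ x∈p → x∉p (there x∈p))

∣p-x∣+1≡∣p∣ : ∀ {m} {x : Fin m} (p : Subset m) → x ∈ p → suc ∣ p - x ∣ ≡ ∣ p ∣
∣p-x∣+1≡∣p∣ {x = 0F}     (true  ∷ p) here      = cong (λ q → suc ∣ q ∣) (p─⊥≡p p)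
∣p-x∣+1≡∣p∣ {x = sucF x} (true  ∷ p) (there x∈p) = cong suc (∣p-x∣+1≡∣p∣ p x∈p)
∣p-x∣+1≡∣p∣ {x = sucF x} (false ∷ p) (there x∈p) = ∣p-x∣+1≡∣p∣ p x∈p

x∉p-x : ∀ {m} {x : Fin m} (p : Subset m) → x ∉ p - x
x∉p-x {x = sucF x} (_ ∷ p) (there x∈p-x) = x∉p-x p x∈p-x

∈p-x⁻ : ∀ {m} {x y : Fin m} (p : Subset m) → y ∈ p - x → y ∈ p × y ≢ x
∈p-x⁻ {x = x} p y∈ = p─q⊆p p ⁅ x ⁆ y∈ , λ { refl → x∉p-x p y∈ }

∈⁅x⁆∪p⁻ : ∀ {m} {x y : Fin m} (p : Subset m) → y ∈ ⁅ x ⁆ ∪ p → y ≡ x ⊎ y ∈ p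
∈⁅x⁆∪p⁻ {x = x} p y∈ with x∈p∪q⁻ ⁅ x ⁆ p y∈
... | inj₁ y∈⁅x⁆ = inj₁ (x∈⁅y⁆⇒x≡y x y∈⁅x⁆)
... | inj₂ y∈p   = inj₂ y∈p

nonempty : ∀ {m} (p : Subset m) → 0 < ∣ p ∣ → Nonempty p
nonempty {m} p 0<∣p∣ with nonempty? p
... | yes ne = ne
... | no ¬ne = ⊥-elim (<⇒≱ 0<∣p∣ (≤-reflexive (trans (cong ∣_∣ (Empty-unique ¬ne)) (∣⊥∣≡0 m))))

twoMembers : ∀ {m} (p : Subset m) → 2 ≤ ∣ p ∣ → ∃[ a ] ∃[ b ] (a ∈ p × b ∈ p × a ≢ b)
twoMembers p 2≤∣p∣ with nonempty p (≤-trans (s≤s z≤n) 2≤∣p∣)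
... | a , a∈p with nonempty (p - a) (≤-pred (subst (2 ≤_) (sym (∣p-x∣+1≡∣p∣ p a∈p)) 2≤∣p∣))
... | b , b∈p-a = a , b , a∈p , proj₁ (∈p-x⁻ p b∈p-a) , ≢-sym (proj₂ (∈p-x⁻ p b∈p-a))

_≟𝟙 : (x : SB) → Dec (x ≡ 𝟙)
𝟘 ≟𝟙 = no λ ()
𝟙 ≟𝟙 = yes refl
ν ≟𝟙 = no λ ()

⊕≡𝟘⁻ : ∀ x y → x ⊕ y ≡ 𝟘 → x ≡ 𝟘 × y ≡ 𝟘
⊕≡𝟘⁻ 𝟘 y e = refl , e
⊕≡𝟘⁻ 𝟙 𝟘 ()
⊕≡𝟘⁻ 𝟙 𝟙 ()
⊕≡𝟘⁻ 𝟙 ν ()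
⊕≡𝟘⁻ ν y ()

⊕≡𝟙⁻ : ∀ x y → x ⊕ y ≡ 𝟙 → (x ≡ 𝟘 × y ≡ 𝟙) ⊎ (x ≡ 𝟙 × y ≡ 𝟘)
⊕≡𝟙⁻ 𝟘 y e = inj₁ (refl , e)
⊕≡𝟙⁻ 𝟙 𝟘 e = inj₂ (refl , refl)
⊕≡𝟙⁻ 𝟙 𝟙 ()
⊕≡𝟙⁻ 𝟙 ν ()
⊕≡𝟙⁻ ν y ()

ΣSB≡𝟘⁺ : ∀ {k} (f : Fin k → SB) → (∀ j → f j ≡ 𝟘) → ΣSB f ≡ 𝟘
ΣSB≡𝟘⁺ {zero}  f f≡𝟘 = refl
ΣSB≡𝟘⁺ {suc k} f f≡𝟘 rewrite f≡𝟘 0F = ΣSB≡𝟘⁺ (λ j → f (sucF j)) (λ j → f≡𝟘 (sucF j))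

ΣSB≡𝟘⁻ : ∀ {k} (f : Fin k → SB) → ΣSB f ≡ 𝟘 → ∀ j → f j ≡ 𝟘
ΣSB≡𝟘⁻ {suc k} f e 0F       = proj₁ (⊕≡𝟘⁻ (f 0F) _ e)
ΣSB≡𝟘⁻ {suc k} f e (sucF j) = ΣSB≡𝟘⁻ (λ j → f (sucF j)) (proj₂ (⊕≡𝟘⁻ (f 0F) _ e)) j

ExactlyOne : ∀ {k} → (Fin k → SB) → Set
ExactlyOne f = ∃[ a ] (f a ≡ 𝟙 × (∀ j → j ≢ a → f j ≡ 𝟘))

ΣSB≡𝟙⁺ : ∀ {k} (f : Fin k → SB) → ExactlyOne f → ΣSB f ≡ 𝟙
ΣSB≡𝟙⁺ {suc k} f (0F , fa≡𝟙 , others)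
  rewrite fa≡𝟙 | ΣSB≡𝟘⁺ (λ j → f (sucF j)) (λ j → others (sucF j) λ ()) = refl
ΣSB≡𝟙⁺ {suc k} f (sucF a , fa≡𝟙 , others) rewrite others 0F (λ ()) =
  ΣSB≡𝟙⁺ (λ j → f (sucF j)) (a , fa≡𝟙 , λ j j≢a → others (sucF j) λ { refl → j≢a refl })

ΣSB≡𝟙⁻ : ∀ {k} (f : Fin k → SB) → ΣSB f ≡ 𝟙 → ExactlyOne f
ΣSB≡𝟙⁻ {suc k} f e with ⊕≡𝟙⁻ (f 0F) _ e
... | inj₂ (f0≡𝟙 , rest≡𝟘) = 0F , f0≡𝟙 , λ
  { 0F       0≢0 → ⊥-elim (0≢0 refl)
  ; (sucF j) _   → ΣSB≡𝟘⁻ (λ j → f (sucF j)) rest≡𝟘 j }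
... | inj₁ (f0≡𝟘 , rest≡𝟙) with ΣSB≡𝟙⁻ (λ j → f (sucF j)) rest≡𝟙
... | a , fa≡𝟙 , others = sucF a , fa≡𝟙 , λ
  { 0F       _   → f0≡𝟘
  ; (sucF j) j≢a → others j (λ { refl → j≢a refl }) }

sum-tabulate≥one : ∀ {m} (f : Fin m → ℕ) a → f a ≤ sum (tabulate f)
sum-tabulate≥one {suc m} f 0F       = m≤m+n (f 0F) _
sum-tabulate≥one {suc m} f (sucF a) = ≤-trans (sum-tabulate≥one (λ i → f (sucF i)) a) (m≤n+m _ (f 0F))

sum-tabulate≥two : ∀ {m} (f : Fin m → ℕ) a b → a ≢ b → f a + f b ≤ sum (tabulate f)
sum-tabulate≥two {suc m} f 0F       0F       a≢b = ⊥-elim (a≢b refl)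
sum-tabulate≥two {suc m} f 0F       (sucF b) a≢b = +-monoʳ-≤ (f 0F) (sum-tabulate≥one (λ i → f (sucF i)) b)
sum-tabulate≥two {suc m} f (sucF a) 0F       a≢b =
  subst (_≤ sum (tabulate f)) (+-comm (f 0F) (f (sucF a)))
        (+-monoʳ-≤ (f 0F) (sum-tabulate≥one (λ i → f (sucF i)) a))
sum-tabulate≥two {suc m} f (sucF a) (sucF b) a≢b =
  ≤-trans (sum-tabulate≥two (λ i → f (sucF i)) a b (λ { refl → a≢b refl })) (m≤n+m _ (f 0F))

sum≥one : ∀ {m} (f : Fin m → ℕ) a → f a ≤ sum (map f (allFin m))
sum≥one f a = subst (f a ≤_) (sym (cong sum (map-tabulate (λ i → i) f))) (sum-tabulate≥one f a)

sum≥two : ∀ {m} (f : Fin m → ℕ) a b → a ≢ b → f a + f b ≤ sum (map f (allFin m))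
sum≥two f a b a≢b =
  subst (f a + f b ≤_) (sym (cong sum (map-tabulate (λ i → i) f))) (sum-tabulate≥two f a b a≢b)

rowTotal : ∀ {m} → (Fin m → Fin m → ℕ) → Fin m → ℕ
rowTotal {m} M i = sum (map (M i) (allFin m))

total : ∀ {m} → (Fin m → Fin m → ℕ) → ℕ
total {m} M = sum (map (rowTotal M) (allFin m))

-- Two entries equal to 1 at different positions make the total at least 2:
-- they lie either in two different rows or in two different columns of one row.
total≥2 : ∀ {m} (M : Fin m → Fin m → ℕ) {p₁ q₁ p₂ q₂} →
          M p₁ q₁ ≡ 1 → M p₂ q₂ ≡ 1 → (p₁ , q₁) ≢ (p₂ , q₂) → 2 ≤ total M
total≥2 M {p₁} {q₁} {p₂} {q₂} e₁ e₂ ne with p₁ ≟ p₂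
... | no p₁≢p₂ = ≤-trans (+-mono-≤ (entry≤row e₁) (entry≤row e₂)) (sum≥two (rowTotal M) p₁ p₂ p₁≢p₂)
  where
  entry≤row : ∀ {p q} → M p q ≡ 1 → 1 ≤ rowTotal M p
  entry≤row {p} {q} e = subst (_≤ rowTotal M p) e (sum≥one (M p) q)
... | yes refl = ≤-trans two≤row (sum≥one (rowTotal M) p₁)
  where
  two≤row : 2 ≤ rowTotal M p₁
  two≤row = subst (_≤ rowTotal M p₁) (cong₂ _+_ e₁ e₂) (sum≥two (M p₁) q₁ q₂ (λ { refl → ne refl }))

fewPairs : ∀ m (R : Fin m → Fin m → Bool) → (∀ v → R v v ≡ false) → m ≤ 2 →
           total (λ i j → if R i j ∧ (toℕ i <ᵇ toℕ j) then 1 else 0) ≤ 1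
fewPairs 0 R irrefl _ = z≤n
fewPairs 1 R irrefl _ rewrite irrefl 0F = z≤n
fewPairs 2 R irrefl _ rewrite irrefl 0F | irrefl (sucF 0F) with R 0F (sucF 0F) | R (sucF 0F) 0F
... | true  | true  = ≤-refl
... | true  | false = ≤-refl
... | false | true  = z≤n
... | false | false = z≤n
fewPairs (suc (suc (suc m))) R irrefl (s≤s (s≤s ()))

≡⇔≤×≰suc : ∀ {k m} → (k ≤ m × ¬ suc k ≤ m) ⇔ m ≡ k
≡⇔≤×≰suc = mk⇔ (λ (k≤m , ¬k<m) → ≤-antisym (≮⇒≥ ¬k<m) k≤m) (λ { refl → ≤-refl , <-irrefl refl })

twoDistinct : ∀ {m} → 2 ≤ m → Σ (Fin m) λ a → Σ (Fin m) λ b → a ≢ b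
twoDistinct (s≤s (s≤s _)) = 0F , sucF 0F , λ ()

threeDistinct : ∀ {m} → 3 ≤ m →
  Σ (Fin m) λ a → Σ (Fin m) λ b → Σ (Fin m) λ c → a ≢ b × a ≢ c × b ≢ c
threeDistinct (s≤s (s≤s (s≤s _))) = 0F , sucF 0F , sucF (sucF 0F) , (λ ()) , (λ ()) , (λ ())

module _ (G : Graph) where

  private
    V : Set
    V = Fin (n G)

  Adj-sym : ∀ {u v} → Adj G u v → Adj G v u
  Adj-sym {u} {v} u∼v = trans (adj-sym G v u) u∼v

  ¬Adj-sym : ∀ {u v} → ¬ Adj G u v → ¬ Adj G v u
  ¬Adj-sym u≁v v∼u = u≁v (Adj-sym v∼u)

  false⇒¬Adj : ∀ {u v} → adj G u v ≡ false → ¬ Adj G u v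
  false⇒¬Adj f t with trans (sym f) t
  ... | ()

  ¬Adj-refl : ∀ v → ¬ Adj G v v
  ¬Adj-refl v = false⇒¬Adj (adj-irrefl G v)

  Adj⇒≢ : ∀ {u v} → Adj G u v → u ≢ v
  Adj⇒≢ {u} u∼u refl = ¬Adj-refl u u∼u

  term : Subset (n G) → V → V → SB
  term c i j = coef c j ⊗ Ac G i j

  term≡𝟙⁺ : ∀ {c i j} → j ∈ c → ¬ Adj G i j → term c i j ≡ 𝟙
  term≡𝟙⁺ {c} {i} {j} j∈c i≁j rewrite []=⇒lookup j∈c with adj G i j
  ... | true  = ⊥-elim (i≁j refl)
  ... | false = refl

  term≡𝟙⁻ : ∀ {c i j} → term c i j ≡ 𝟙 → j ∈ c × ¬ Adj G i j
  term≡𝟙⁻ {c} {i} {j} t with lookup c j in l | adj G i j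
  ... | true  | false = lookup⇒[]= j c l , λ ()
  term≡𝟙⁻ () | true  | true
  term≡𝟙⁻ () | false | _

  term≡𝟘⁺ : ∀ {c i j} → (j ∈ c → Adj G i j) → term c i j ≡ 𝟘
  term≡𝟘⁺ {c} {i} {j} i∼j with lookup c j in l | adj G i j
  ... | false | _     = refl
  ... | true  | true  = refl
  ... | true  | false with () ← i∼j (lookup⇒[]= j c l)

  term≡𝟘⁻ : ∀ {c i j} → term c i j ≡ 𝟘 → j ∈ c → Adj G i j
  term≡𝟘⁻ {c} {i} {j} t j∈c rewrite []=⇒lookup j∈c with adj G i j
  ... | true = refl
  term≡𝟘⁻ () j∈c | false

  Isolates : Subset (n G) → V → V → Set
  Isolates c i a = a ∈ c × ¬ Adj G i a × (∀ {j} → j ∈ c → j ≢ a → Adj G i j)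

  Isolable : Subset (n G) → Set
  Isolable c = ∃[ i ] ∃[ a ] Isolates c i a

  combo≡𝟙⁺ : ∀ {c i a} → Isolates c i a → combo G c i ≡ 𝟙
  combo≡𝟙⁺ {c} {i} {a} (a∈c , i≁a , i∼rest) =
    ΣSB≡𝟙⁺ (term c i) (a , term≡𝟙⁺ a∈c i≁a , λ j j≢a → term≡𝟘⁺ (λ j∈c → i∼rest j∈c j≢a))

  combo≡𝟙⁻ : ∀ {c i} → combo G c i ≡ 𝟙 → ∃[ a ] Isolates c i a
  combo≡𝟙⁻ {c} {i} e with ΣSB≡𝟙⁻ (term c i) e
  ... | a , t≡𝟙 , others with term≡𝟙⁻ {c} t≡𝟙
  ... | a∈c , i≁a = a , a∈c , i≁a , λ {j} j∈c j≢a → term≡𝟘⁻ {c} (others j j≢a) j∈c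

  isolable⇒independent : ∀ {S} → (∀ {c} → c ⊆ S → Nonempty c → Isolable c) → Independent G S
  isolable⇒independent isolable (c , c⊆S , ne , no𝟙) with isolable c⊆S ne
  ... | i , a , iso = no𝟙 i (combo≡𝟙⁺ iso)

  independent⇒isolable : ∀ {S c} → Independent G S → c ⊆ S → Nonempty c → Isolable c
  independent⇒isolable {c = c} ind c⊆S ne with any? (λ i → combo G c i ≟𝟙)
  ... | yes (i , e) = i , combo≡𝟙⁻ e
  ... | no  ¬𝟙      = ⊥-elim (ind (c , c⊆S , ne , λ i e → ¬𝟙 (i , e)))

  crkEq⇔ : ∀ {r} → CRkEq G r ⇔ (CRkGe G r × ¬ CRkGe G (suc r))
  crkEq⇔ {r} = mk⇔ to from
    where
    to : CRkEq G r → CRkGe G r × ¬ CRkGe G (suc r)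
    to ((S , ind , ∣S∣≡r) , maximal) =
      (S , ind , ≤-reflexive (sym ∣S∣≡r)) , λ (T , indT , r<∣T∣) → <⇒≱ r<∣T∣ (maximal T indT)
    from : CRkGe G r × ¬ CRkGe G (suc r) → CRkEq G r
    from ((S , ind , r≤∣S∣) , ¬bigger) =
      (S , ind , ≤-antisym (atMost S ind) r≤∣S∣) , atMost
      where
      atMost : ∀ T → Independent G T → ∣ T ∣ ≤ r
      atMost T indT = ≮⇒≥ (λ r<∣T∣ → ¬bigger (T , indT , r<∣T∣))

  crkGe⇒≤n : ∀ {k} → CRkGe G k → k ≤ n G
  crkGe⇒≤n (S , _ , k≤∣S∣) = ≤-trans k≤∣S∣ (∣p∣≤n S)

  IndepOf : ℕ → (V → Set) → Set
  IndepOf k P = ∃[ S ] (Independent G S × ∣ S ∣ ≡ k × (∀ {j} → j ∈ S → P j))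

  -- Such a set witnesses c-rk G ≥ k; the predicate P records what is known about its members.
  IndepOf⇒CRkGe : ∀ {k P} → IndepOf k P → CRkGe G k
  IndepOf⇒CRkGe (S , ind , ∣S∣≡k , _) = S , ind , ≤-reflexive (sym ∣S∣≡k)

  weaken : ∀ {k P Q} → IndepOf k P → (∀ {j} → P j → Q j) → IndepOf k Q
  weaken (S , ind , size , mem) P⇒Q = S , ind , size , λ j∈S → P⇒Q (mem j∈S)

  -- The empty set of columns is independent: a dependency needs a nonempty support.
  noColumns : IndepOf 0 (λ _ → ⊥)
  noColumns = ∅ , (λ (c , c⊆∅ , (x , x∈c) , _) → ∉⊥ (c⊆∅ x∈c)) , ∣⊥∣≡0 (n G) , λ j∈∅ → ⊥-elim (∉⊥ j∈∅)

  SeesAll : V → (V → Set) → Set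
  SeesAll r P = ∀ {j} → P j → Adj G r j

  -- Extension lemma: if row r misses a but sees every column of an independent set S,
  -- then a can be added to S (r isolates a in every subset containing it).
  extend : ∀ {k P} → IndepOf k P → (a r : V) → ¬ Adj G r a → SeesAll r P →
           IndepOf (suc k) (λ j → j ≡ a ⊎ P j)
  extend {k} {P} (S , ind , ∣S∣≡k , mem) a r r≁a r∼P = ⁅ a ⁆ ∪ S , independent , size , mem′
    where
    a∉S : a ∉ S
    a∉S a∈S = r≁a (r∼P (mem a∈S))

    old : ∀ {j} → j ∈ ⁅ a ⁆ ∪ S → j ≢ a → j ∈ S
    old j∈ j≢a with ∈⁅x⁆∪p⁻ S j∈
    ... | inj₁ j≡a = ⊥-elim (j≢a j≡a)
    ... | inj₂ j∈S = j∈S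

    isolable : ∀ {c} → c ⊆ ⁅ a ⁆ ∪ S → Nonempty c → Isolable c
    isolable {c} c⊆ ne with a ∈? c
    ... | yes a∈c = r , a , a∈c , r≁a , λ j∈c j≢a → r∼P (mem (old (c⊆ j∈c) j≢a))
    ... | no  a∉c = independent⇒isolable ind (λ j∈c → old (c⊆ j∈c) (λ { refl → a∉c j∈c })) ne

    independent : Independent G (⁅ a ⁆ ∪ S)
    independent = isolable⇒independent isolable

    size : ∣ ⁅ a ⁆ ∪ S ∣ ≡ suc k
    size = trans (∣⁅x⁆∪p∣≡1+∣p∣ S a∉S) (cong suc ∣S∣≡k)

    mem′ : ∀ {j} → j ∈ ⁅ a ⁆ ∪ S → j ≡ a ⊎ P j
    mem′ j∈ with ∈⁅x⁆∪p⁻ S j∈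
    ... | inj₁ j≡a = inj₁ j≡a
    ... | inj₂ j∈S = inj₂ (mem j∈S)

  -- Every single column is independent, isolated by its own row (G has no loops).
  singleton : (q : V) → IndepOf 1 (λ j → j ≡ q ⊎ ⊥)
  singleton q = extend noColumns q q (¬Adj-refl q) (λ ())

  Separates : V → V → V → Set
  Separates w u v = Adj G u w × ¬ Adj G v w

  separate : Sober G → ∀ {u v} → u ≢ v → (∃[ w ] Separates w u v) ⊎ (∃[ w ] Separates w v u)
  separate sob {u} {v} u≢v
    with ¬∀⟶∃¬ (n G) (λ w → adj G u w ≡ adj G v w) (λ w → adj G u w Bool.≟ adj G v w)
               (λ same → u≢v (sob u v same))
  ... | w , differ with adj G u w in eu | adj G v w in ev
  ... | true  | true  = ⊥-elim (differ refl)
  ... | false | false = ⊥-elim (differ refl)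
  ... | true  | false = inj₁ (w , eu , false⇒¬Adj ev)
  ... | false | true  = inj₂ (w , ev , false⇒¬Adj eu)

  pairBy : ∀ {w u v} → Separates w u v → IndepOf 2 (λ j → j ≡ v ⊎ j ≡ u ⊎ ⊥)
  pairBy {w} {u} {v} (u∼w , v≁w) =
    extend (singleton u) v w (¬Adj-sym v≁w) (λ { (inj₁ refl) → Adj-sym u∼w })

  pair : Sober G → ∀ {p q} → p ≢ q → IndepOf 2 (λ j → j ≡ p ⊎ j ≡ q)
  pair sob p≢q with separate sob p≢q
  ... | inj₁ (_ , sep) = weaken (pairBy sep) λ { (inj₁ e) → inj₂ e ; (inj₂ (inj₁ e)) → inj₁ e }
  ... | inj₂ (_ , sep) = weaken (pairBy sep) λ { (inj₁ e) → inj₁ e ; (inj₂ (inj₁ e)) → inj₂ e }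

  -- Two distinct vertices x, y seeing every column of an independent set let it grow by two:
  -- with w separating x from y, add w (isolated by row y), then x (isolated by row x itself).
  addTwoBy : ∀ {k P w x y} → IndepOf k P → Separates w x y → SeesAll x P → SeesAll y P →
             CRkGe G (suc (suc k))
  addTwoBy {w = w} {x} {y} S (x∼w , y≁w) x∼P y∼P =
    IndepOf⇒CRkGe (extend (extend S w y y≁w y∼P) x x (¬Adj-refl x)
                     λ { (inj₁ refl) → x∼w ; (inj₂ pj) → x∼P pj })

  addTwo : Sober G → ∀ {k P x y} → IndepOf k P → x ≢ y → SeesAll x P → SeesAll y P →
           CRkGe G (suc (suc k))
  addTwo sob S x≢y x∼P y∼P with separate sob x≢y
  ... | inj₁ (_ , sep) = addTwoBy S sep x∼P y∼P
  ... | inj₂ (_ , sep) = addTwoBy S sep y∼P x∼P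

  peel : ∀ {S c m} → Independent G S → c ⊆ S → suc m ≤ ∣ c ∣ →
         ∃[ i ] ∃[ a ] (Isolates c i a × m ≤ ∣ c - a ∣)
  peel {c = c} ind c⊆S m<∣c∣ with independent⇒isolable ind c⊆S (nonempty c (≤-trans (s≤s z≤n) m<∣c∣))
  ... | i , a , iso@(a∈c , _) = i , a , iso , ≤-pred (subst (_ ≤_) (sym (∣p-x∣+1≡∣p∣ c a∈c)) m<∣c∣)

  sees-rest : ∀ {c i a j} → Isolates c i a → j ∈ c - a → Adj G i j
  sees-rest {c} (_ , _ , i∼rest) j∈ = i∼rest (proj₁ (∈p-x⁻ c j∈)) (proj₂ (∈p-x⁻ c j∈))

  twoRows : ∀ {S m} → Independent G S → suc (suc m) ≤ ∣ S ∣ →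
            ∃[ x ] ∃[ y ] ∃[ T ] (x ≢ y × T ⊆ S × m ≤ ∣ T ∣ × (∀ {j} → j ∈ T → Adj G x j × Adj G y j))
  twoRows {S} ind size with peel ind (λ j∈S → j∈S) size
  ... | x , e , isoE , size₁ with peel ind (λ j∈ → proj₁ (∈p-x⁻ S j∈)) size₁
  ... | y , d , isoD@(d∈S-e , y≁d , _) , size₂ =
    x , y , S - e - d , x≢y , (λ j∈T → proj₁ (∈p-x⁻ S (T⊆S-e j∈T))) , size₂ ,
    λ j∈T → sees-rest isoE (T⊆S-e j∈T) , sees-rest isoD j∈T
    where
    T⊆S-e : S - e - d ⊆ S - e
    T⊆S-e j∈ = proj₁ (∈p-x⁻ (S - e) j∈)
    x≢y : x ≢ y
    x≢y refl = y≁d (sees-rest isoE d∈S-e)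

  crkGe4⇒square : CRkGe G 4 → HasSquare G
  crkGe4⇒square (S , ind , 4≤∣S∣) with twoRows ind 4≤∣S∣
  ... | x , y , T , x≢y , _ , 2≤∣T∣ , common with twoMembers T 2≤∣T∣
  ... | a , b , a∈T , b∈T , a≢b with common a∈T | common b∈T
  ... | x∼a , y∼a | x∼b , y∼b =
    x , a , y , b ,
    (Adj⇒≢ x∼a , x≢y , Adj⇒≢ x∼b , ≢-sym (Adj⇒≢ y∼a) , a≢b , Adj⇒≢ y∼b) ,
    (x∼a , Adj-sym y∼a , y∼b , Adj-sym x∼b)

  -- Five independent columns force the configuration of HasFive: x and y are both adjacent
  -- to a, b, k, and a further peeling row z sees a and b but misses k.
  crkGe5⇒five : CRkGe G 5 → HasFive G
  crkGe5⇒five (S , ind , 5≤∣S∣) with twoRows ind 5≤∣S∣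
  ... | x , y , T , x≢y , T⊆S , 3≤∣T∣ , common with peel ind T⊆S 3≤∣T∣
  ... | z , k , isoK@(k∈T , z≁k , _) , 2≤∣T-k∣ with twoMembers (T - k) 2≤∣T-k∣
  ... | a , b , a∈T-k , b∈T-k , a≢b
    with ∈p-x⁻ T a∈T-k | ∈p-x⁻ T b∈T-k
  ... | a∈T , a≢k | b∈T , b≢k with common a∈T | common b∈T | common k∈T
  ... | x∼a , y∼a | x∼b , y∼b | x∼k , y∼k =
    x , a , b , k , y ,
    (Adj⇒≢ x∼a , Adj⇒≢ x∼b , Adj⇒≢ x∼k , x≢y , a≢b ,
     a≢k , ≢-sym (Adj⇒≢ y∼a) , b≢k , ≢-sym (Adj⇒≢ y∼b) , ≢-sym (Adj⇒≢ y∼k)) ,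
    (x∼a , x∼b , x∼k , y∼a , y∼b , y∼k) ,
    (z , Adj-sym (sees-rest isoK a∈T-k) , Adj-sym (sees-rest isoK b∈T-k) , ¬Adj-sym z≁k)

  -- Conversely a square yields four independent columns: b, d are independent and a ≠ c see both.
  square⇒crkGe4 : Sober G → HasSquare G → CRkGe G 4
  square⇒crkGe4 sob (a , b , c , d , (_ , a≢c , _ , _ , b≢d , _) , (a∼b , b∼c , c∼d , d∼a)) =
    addTwo sob (pair sob b≢d) a≢c
      (λ { (inj₁ refl) → a∼b ; (inj₂ refl) → Adj-sym d∼a })
      (λ { (inj₁ refl) → Adj-sym b∼c ; (inj₂ refl) → c∼d })

  -- and the configuration of HasFive yields five: v₂, v₃, v₄ are independent (w isolates v₄),
  -- and v₁ ≠ v₅ see all three.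
  five⇒crkGe5 : Sober G → HasFive G → CRkGe G 5
  five⇒crkGe5 sob (v₁ , v₂ , v₃ , v₄ , v₅ , (_ , _ , _ , v₁≢v₅ , v₂≢v₃ , _) ,
                   (v₁∼v₂ , v₁∼v₃ , v₁∼v₄ , v₅∼v₂ , v₅∼v₃ , v₅∼v₄) , (w , v₂∼w , v₃∼w , v₄≁w)) =
    addTwo sob three v₁≢v₅
      (λ { (inj₁ refl) → v₁∼v₄ ; (inj₂ (inj₁ refl)) → v₁∼v₂ ; (inj₂ (inj₂ refl)) → v₁∼v₃ })
      (λ { (inj₁ refl) → v₅∼v₄ ; (inj₂ (inj₁ refl)) → v₅∼v₂ ; (inj₂ (inj₂ refl)) → v₅∼v₃ })
    where
    three : IndepOf 3 (λ j → j ≡ v₄ ⊎ j ≡ v₂ ⊎ j ≡ v₃)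
    three = extend (pair sob v₂≢v₃) v₄ w (¬Adj-sym v₄≁w)
              (λ { (inj₁ refl) → Adj-sym v₂∼w ; (inj₂ refl) → Adj-sym v₃∼w })

  crkGe4⇔square : Sober G → CRkGe G 4 ⇔ HasSquare G
  crkGe4⇔square sob = mk⇔ crkGe4⇒square (square⇒crkGe4 sob)

  crkGe5⇔five : Sober G → CRkGe G 5 ⇔ HasFive G
  crkGe5⇔five sob = mk⇔ crkGe5⇒five (five⇒crkGe5 sob)

  firstStep : ∀ {u v} → u ≢ v → Reachable G u v → ∃[ w ] Adj G u w
  firstStep u≢u here = ⊥-elim (u≢u refl)
  firstStep _ (step {v = w} u∼w _) = w , u∼w

  crossing : (C : V → Set) → (∀ v → Dec (C v)) → ∀ {u t} → C u → ¬ C t → Reachable G u t →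
             ∃[ x ] ∃[ y ] (C x × ¬ C y × Adj G x y)
  crossing C C? Cu ¬Ct here = ⊥-elim (¬Ct Cu)
  crossing C C? Cu ¬Ct (step {v = v} u∼v walk) with C? v
  ... | yes Cv = crossing C C? Cv ¬Ct walk
  ... | no ¬Cv = _ , v , Cu , ¬Cv , u∼v

  Path2 : Set
  Path2 = ∃[ x ] ∃[ y ] ∃[ z ] (Adj G x y × Adj G y z × x ≢ z)

  -- In a connected graph, an edge a – v and a vertex t outside {a, v} give a path of length two:
  -- the walk from a to t leaves {a, v} along an edge, which extends a – v.
  edge⇒path2 : Connected G → ∀ {a v t} → Adj G a v → t ≢ a → t ≢ v → Path2
  edge⇒path2 con {a} {v} {t} a∼v t≢a t≢v
    with crossing (λ j → j ≡ a ⊎ j ≡ v) (λ j → (j ≟ a) ⊎-dec (j ≟ v)) (inj₁ refl)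
                  (λ { (inj₁ t≡a) → t≢a t≡a ; (inj₂ t≡v) → t≢v t≡v }) (con a t)
  ... | x , y , inj₁ refl , y∉ , a∼y = v , a , y , Adj-sym a∼v , a∼y , λ { refl → y∉ (inj₂ refl) }
  ... | x , y , inj₂ refl , y∉ , v∼y = a , v , y , a∼v , v∼y , λ { refl → y∉ (inj₁ refl) }

  connected⇒path2 : Connected G → 3 ≤ n G → Path2
  connected⇒path2 con 3≤n with threeDistinct 3≤n
  ... | a , b , c , a≢b , a≢c , b≢c with firstStep a≢b (con a b)
  ... | v , a∼v with v ≟ b
  ... | yes refl = edge⇒path2 con a∼v (≢-sym a≢c) (≢-sym b≢c)
  ... | no  v≢b  = edge⇒path2 con a∼v (≢-sym a≢b) (≢-sym v≢b)

  edgeEntry : V → V → ℕ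
  edgeEntry i j = if adj G i j ∧ (toℕ i <ᵇ toℕ j) then 1 else 0

  counted : ∀ {p q} → Adj G p q → toℕ p < toℕ q → edgeEntry p q ≡ 1
  counted p∼q p<q rewrite p∼q | Equivalence.to T-≡ (<⇒<ᵇ p<q) = refl

  orient : ∀ {x y} → Adj G x y →
           ∃[ e ] (edgeEntry (proj₁ e) (proj₂ e) ≡ 1 × (e ≡ (x , y) ⊎ e ≡ (y , x)))
  orient {x} {y} x∼y with toℕ x <? toℕ y
  ... | yes x<y = (x , y) , counted x∼y x<y , inj₁ refl
  ... | no  x≮y = (y , x) , counted (Adj-sym x∼y) y<x , inj₂ refl
    where
    y<x : toℕ y < toℕ x
    y<x = ≤∧≢⇒< (≮⇒≥ x≮y) (λ e → Adj⇒≢ x∼y (toℕ-injective (sym e)))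

  path2⇒twoEdges : Path2 → 2 ≤ numEdges G
  path2⇒twoEdges (x , y , z , x∼y , y∼z , x≢z) with orient x∼y | orient y∼z
  ... | e₁ , c₁ , o₁ | e₂ , c₂ , o₂ = total≥2 edgeEntry c₁ c₂ (different o₁ o₂)
    where
    different : ∀ {e₁ e₂} → (e₁ ≡ (x , y) ⊎ e₁ ≡ (y , x)) → (e₂ ≡ (y , z) ⊎ e₂ ≡ (z , y)) → e₁ ≢ e₂
    different (inj₁ refl) (inj₁ refl) e = Adj⇒≢ x∼y (cong proj₁ e)
    different (inj₁ refl) (inj₂ refl) e = x≢z (cong proj₁ e)
    different (inj₂ refl) (inj₁ refl) e = x≢z (cong proj₂ e)
    different (inj₂ refl) (inj₂ refl) e = Adj⇒≢ y∼z (cong proj₁ e)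

  twoEdges⇔ : Connected G → (2 ≤ numEdges G ⇔ 3 ≤ n G)
  twoEdges⇔ con = mk⇔ to (λ 3≤n → path2⇒twoEdges (connected⇒path2 con 3≤n))
    where
    to : 2 ≤ numEdges G → 3 ≤ n G
    to 2≤e with n G ≤? 2
    ... | yes n≤2 = ⊥-elim (<⇒≱ 2≤e (fewPairs (n G) (adj G) (adj-irrefl G) n≤2))
    ... | no  n≰2 = ≰⇒> n≰2

≅⇒sameOrder : ∀ {G H} → G ≅ H → n G ≡ n H
≅⇒sameOrder (f , _) =
  cantor-schröder-bernstein (Injection.injective (↔⇒↣ f)) (Injection.injective (↔⇒↣ (↔-sym f)))

n≡1⇒≅K₁ : (G : Graph) → n G ≡ 1 → G ≅ complete 1
n≡1⇒≅K₁ record { n = .1 ; adj-irrefl = irrefl } refl = ↔-refl , λ { 0F 0F → sym (irrefl 0F) }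

n≡2⇒≅K₂ : (G : Graph) → Connected G → n G ≡ 2 → G ≅ complete 2
n≡2⇒≅K₂ G@record { n = .2 ; adj = a ; adj-sym = a-sym ; adj-irrefl = irrefl } con refl = ↔-refl , same
  where
  0∼1 : a 0F (sucF 0F) ≡ true
  0∼1 with firstStep G (λ ()) (con 0F (sucF 0F))
  ... | 0F      , 0∼0 = ⊥-elim (¬Adj-refl G 0F 0∼0)
  ... | sucF 0F , 0∼1 = 0∼1

  same : ∀ u v → adj (complete 2) u v ≡ a u v
  same 0F        0F        = sym (irrefl 0F)
  same 0F        (sucF 0F) = sym 0∼1
  same (sucF 0F) 0F        = sym (trans (a-sym (sucF 0F) 0F) 0∼1)
  same (sucF 0F) (sucF 0F) = sym (irrefl (sucF 0F))

≅K₁⇔ : (G : Graph) → G ≅ complete 1 ⇔ n G ≡ 1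
≅K₁⇔ G = mk⇔ (≅⇒sameOrder {G} {complete 1}) (n≡1⇒≅K₁ G)

≅K₂⇔ : (G : Graph) → Connected G → G ≅ complete 2 ⇔ n G ≡ 2
≅K₂⇔ G con = mk⇔ (≅⇒sameOrder {G} {complete 2}) (n≡2⇒≅K₂ G con)

module _ (G : Graph) (sob : Sober G) (con : Connected G) where

  -- For k ≤ 3, c-rk G ≥ k just says that G has at least k vertices: a single column, two
  -- distinct columns, or the ends x, z of a path x – y – z extended by y (isolated by row y).
  crkGe⇔order : ∀ {k} → k ≤ 3 → CRkGe G k ⇔ k ≤ n G
  crkGe⇔order k≤3 = mk⇔ (crkGe⇒≤n G) (lower k≤3)
    where
    lower : ∀ {k} → k ≤ 3 → k ≤ n G → CRkGe G k
    lower z≤n _ = IndepOf⇒CRkGe G (noColumns G)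
    lower (s≤s z≤n) 1≤n = IndepOf⇒CRkGe G (singleton G (fromℕ< 1≤n))
    lower (s≤s (s≤s z≤n)) 2≤n with twoDistinct 2≤n
    ... | a , b , a≢b = IndepOf⇒CRkGe G (pair G sob a≢b)
    lower (s≤s (s≤s (s≤s z≤n))) 3≤n with connected⇒path2 G con 3≤n
    ... | x , y , z , x∼y , y∼z , x≢z =
      IndepOf⇒CRkGe G (extend G (pair G sob x≢z) y y (¬Adj-refl G y)
                         (λ { (inj₁ refl) → Adj-sym G x∼y ; (inj₂ refl) → y∼z }))

  crkEq⇔order : ∀ {k} → k ≤ 2 → CRkEq G k ⇔ n G ≡ k
  crkEq⇔order k≤2 =
    ⇔-trans (crkEq⇔ G)
      (⇔-trans (crkGe⇔order (m≤n⇒m≤1+n k≤2) ×-⇔ ¬-cong-⇔ (crkGe⇔order (s≤s k≤2))) ≡⇔≤×≰suc)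

corollary4p5 : (G : Graph) → Sober G → Connected G →
    (CRkEq G 0 ⇔ n G ≡ 0) ×
    (CRkEq G 1 ⇔ G ≅ complete 1) ×
    (CRkEq G 2 ⇔ G ≅ complete 2) ×
    (CRkEq G 3 ⇔ (2 ≤ numEdges G × ¬ HasSquare G)) ×
    (CRkEq G 4 ⇔ (HasSquare G × ¬ HasFive G)) ×
    (CRkGe G 5 ⇔ HasFive G)
corollary4p5 G sob con =
  crkEq⇔order G sob con z≤n ,
  ⇔-trans (crkEq⇔order G sob con (s≤s z≤n)) (⇔-sym (≅K₁⇔ G)) ,
  ⇔-trans (crkEq⇔order G sob con (s≤s (s≤s z≤n))) (⇔-sym (≅K₂⇔ G con)) ,
  ⇔-trans (crkEq⇔ G)
    (⇔-trans (crkGe⇔order G sob con ≤-refl) (⇔-sym (twoEdges⇔ G con))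
       ×-⇔ ¬-cong-⇔ (crkGe4⇔square G sob)) ,
  ⇔-trans (crkEq⇔ G) (crkGe4⇔square G sob ×-⇔ ¬-cong-⇔ (crkGe5⇔five G sob)) ,
  crkGe5⇔five G sob
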